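{- Let $\alpha_1,\dots,\alpha_r\in\mathbb{Z}$ be squarefree, assume that every prime $p\mid\alpha_i$ (for any $i$) satisfies $\chi(p)=-1$, and assume that $\alpha_1\cdots\alpha_r$ is a square. If $Y^*_{\Delta,f_1,\dots,f_r,\alpha_1,\dots,\alpha_r}(\mathbb{Q})\neq\emptyset$, then for each $i$, $$\alpha_i\ \Big|\ \prod_{j\neq i}\mathrm{Res}(F_i,F_j).$$
   Context: $\Delta$ is a squarefree integer with $\sqrt{ -\Delta}\notin\mathbb{Q}$ and $\chi$ is the quadratic character attached to $\mathbb{Q}(\sqrt{ -\Delta})$. $f\in\mathbb{Z}[z]$ is separable of degree $3$ or $4$ with factorization into irreducibles $f=f_1\cdots f_r$, and $F_1,\dots,F_r$ are the corresponding irreducible binary forms with $F_1\cdots F_r=F$, the quartic homogenization $F(u,v)=v^4f(u/v)$. $\mathrm{Res}(F_i,F_j)$ is the resultant. Define $Y^*_{\Delta,f_1,\dots,f_r,\alpha_1,\dots,\alpha_r}=\{((x_i,y_i,t_i)_{i=1}^r,u,v): x_i^2+\Delta y_i^2=\alpha_it_i^2F_i(u,v)\neq0,\ \gcd(x_i,y_i,t_i)=\gcd(u,v)=1\ \forall i\}$, and $Y^*(\mathbb{Q})\neq\emptyset$ means it has a point with all coordinates integers. -}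

module Defs where

open import Data.Bool using (Bool; true; false; if_then_else_)
open import Data.Nat as ℕ using (ℕ; zero; suc)
open import Data.Nat.Primality using (Prime)
open import Data.Integer as ℤ using (ℤ; +_; _+_; _*_; _-_; -_; ∣_∣; 0ℤ; 1ℤ; -1ℤ)
open import Data.Integer.DivMod using (_%ℕ_)
open import Data.Integer.Divisibility using (_∣_)
open import Data.Integer.GCD using (gcd)
open import Data.Nat.Divisibility using () renaming (_∣_ to _∣ℕ_)
open import Data.Fin as Fin using (Fin; toℕ; punchIn)
open import Data.Fin.Properties using () renaming (_≟_ to _≟F_)
open import Data.List using (List; []; _∷_)
open import Data.Product using (Σ; _×_; _,_; ∃)
open import Data.Sum using (_⊎_)
open import Relation.Nullary using (¬_; yes; no)
open import Relation.Binary.PropositionalEquality using (_≡_; _≢_)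

sumℕ : ℕ → (ℕ → ℤ) → ℤ
sumℕ zero    g = 0ℤ
sumℕ (suc n) g = sumℕ n g + g n

sumFin : (n : ℕ) → (Fin n → ℤ) → ℤ
sumFin zero    g = 0ℤ
sumFin (suc n) g = g Fin.zero + sumFin n (λ j → g (Fin.suc j))

prodFin : (n : ℕ) → (Fin n → ℤ) → ℤ
prodFin zero    g = 1ℤ
prodFin (suc n) g = g Fin.zero * prodFin n (λ j → g (Fin.suc j))

prodExcept : (n : ℕ) → Fin n → (Fin n → ℤ) → ℤ
prodExcept n i g = prodFin n (λ j → h j)
  where
  h : Fin n → ℤ
  h j with i ≟F j
  ... | yes _ = 1ℤ
  ... | no  _ = g j

Squarefree : ℤ → Set
Squarefree n = n ≢ 0ℤ × (∀ (m : ℕ) → (m ℕ.* m) ∣ℕ ∣ n ∣ → m ≡ 1)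

IsSquare : ℤ → Set
IsSquare n = Σ ℤ (λ s → n ≡ s * s)

-- The quadratic character χ of K = ℚ(√-Δ), i.e. the Kronecker symbol
-- (d_K / ·) of the fundamental discriminant d_K of K.

discK : ℤ → ℤ
discK Δ = if ((- Δ) %ℕ 4) ℕ.≡ᵇ 1 then - Δ else + 4 * (- Δ)

χ≡-1 : ℤ → ℕ → Set
χ≡-1 Δ p =
  (p ≡ 2 × ((discK Δ %ℕ 8 ≡ 3) ⊎ (discK Δ %ℕ 8 ≡ 5)))
  ⊎ (p ≢ 2 × (¬ (+ p ∣ discK Δ)) × (¬ Σ ℤ (λ x → + p ∣ (x * x - discK Δ))))

-- Univariate polynomials over ℤ: coefficient lists c₀ ∷ c₁ ∷ … (ascending).
-- Trailing zeros are allowed; polynomials are compared coefficientwise.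

coeff : List ℤ → ℕ → ℤ
coeff []       k       = 0ℤ
coeff (c ∷ cs) zero    = c
coeff (c ∷ cs) (suc k) = coeff cs k

conv : (ℕ → ℤ) → (ℕ → ℤ) → ℕ → ℤ
conv a b k = sumℕ (suc k) (λ i → a i * b (k ℕ.∸ i))

deriv : (ℕ → ℤ) → ℕ → ℤ
deriv a k = + (suc k) * a (suc k)

HasDegree : List ℤ → ℕ → Set
HasDegree f d = coeff f d ≢ 0ℤ × (∀ k → d ℕ.< k → coeff f k ≡ 0ℤ)

-- f is separable: gcd(f, f') = 1 in ℚ[z], i.e. a·f + b·f' = c for some
-- a, b ∈ ℤ[z] and a nonzero constant c ∈ ℤ
Separable : List ℤ → Set
Separable f =
  Σ (List ℤ) λ a → Σ (List ℤ) λ b → Σ ℤ λ c → c ≢ 0ℤ ×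
    (∀ k → conv (coeff a) (coeff f) k + conv (coeff b) (deriv (coeff f)) k
           ≡ coeff (c ∷ []) k)

-- Binary forms over ℤ:  F(u,v) = Σ_{k=0}^{d} coef k · u^(d-k) v^k

record Form : Set where
  constructor form
  field
    deg  : ℕ
    coef : Fin (suc deg) → ℤ
open Form public

coefAt : Form → ℕ → ℤ
coefAt F k with k ℕ.<? suc (deg F)
... | yes k<d = coef F (Fin.fromℕ< k<d)
... | no  _   = 0ℤ

formMul : Form → Form → Form
formMul F G = form (deg F ℕ.+ deg G) (λ k → conv (coefAt F) (coefAt G) (toℕ k))

oneForm : Form
oneForm = form 0 (λ _ → 1ℤ)

prodForms : (r : ℕ) → (Fin r → Form) → Form
prodForms zero    F = oneForm
prodForms (suc r) F = formMul (F Fin.zero) (prodForms r (λ j → F (Fin.suc j)))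

_≈F_ : Form → Form → Set
F ≈F G = deg F ≡ deg G × (∀ k → coefAt F k ≡ coefAt G k)

evalF : Form → ℤ → ℤ → ℤ
evalF F u v =
  sumℕ (suc (deg F)) (λ k → coefAt F k * (u ℤ.^ (deg F ℕ.∸ k)) * (v ℤ.^ k))

-- units of ℤ[u,v] are ±1
IsUnitForm : Form → Set
IsUnitForm G = deg G ≡ 0 × (coefAt G 0 ≡ 1ℤ ⊎ coefAt G 0 ≡ -1ℤ)

-- irreducible (nonconstant) binary form in ℤ[u,v]
-- (any factor of a homogeneous polynomial is homogeneous)
IrreducibleForm : Form → Set
IrreducibleForm F =
  1 ℕ.≤ deg F × (∀ G H → F ≈F formMul G H → IsUnitForm G ⊎ IsUnitForm H)

-- quartic homogenization F(u,v) = v⁴ f(u/v) of f = Σ c_k z^k (deg f ≤ 4)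
homog4 : List ℤ → Form
homog4 f = form 4 (λ k → coeff f (4 ℕ.∸ toℕ k))

alt : ℕ → ℤ
alt zero    = 1ℤ
alt (suc k) = - alt k

det : (n : ℕ) → (Fin n → Fin n → ℤ) → ℤ
det zero    M = 1ℤ
det (suc n) M =
  sumFin (suc n) (λ j → alt (toℕ j) * M Fin.zero j
                        * det n (λ a b → M (Fin.suc a) (punchIn j b)))

shifted : (ℕ → ℤ) → ℕ → ℕ → ℤ
shifted c s col = if s ℕ.≤ᵇ col then c (col ℕ.∸ s) else 0ℤ

sylvester : (F G : Form) → Fin (deg F ℕ.+ deg G) → Fin (deg F ℕ.+ deg G) → ℤ
sylvester F G row col =
  if toℕ row ℕ.<ᵇ deg G
  then shifted (coefAt F) (toℕ row) (toℕ col)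
  else shifted (coefAt G) (toℕ row ℕ.∸ deg G) (toℕ col)

Res : Form → Form → ℤ
Res F G = det (deg F ℕ.+ deg G) (sylvester F G)

YStarNonempty : ℤ → (r : ℕ) → (Fin r → Form) → (Fin r → ℤ) → Set
YStarNonempty Δ r F α =
  Σ (Fin r → ℤ) λ x → Σ (Fin r → ℤ) λ y → Σ (Fin r → ℤ) λ t →
  Σ ℤ λ u → Σ ℤ λ v →
    (∀ i → (x i * x i + Δ * (y i * y i) ≡ α i * (t i * t i) * evalF (F i) u v)
         × (α i * (t i * t i) * evalF (F i) u v ≢ 0ℤ)
         × (gcd (gcd (x i) (y i)) (t i) ≡ 1ℤ))
    × gcd u v ≡ 1ℤ

-- Let p be a prime dividing αᵢ. Since χ(p) = -1, p is inert in ℚ(√-Δ): if p divides x² + Δy²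
-- exactly once up to squares, then p ∣ x and p ∣ y. As αᵢ is squarefree and gcd(xᵢ, yᵢ, tᵢ) = 1,
-- this forces p ∣ Fᵢ(u, v), for otherwise p would divide xᵢ, yᵢ and then tᵢ. Because ∏ αⱼ is a
-- square, p also divides some αⱼ with j ≠ i, hence p ∣ Fⱼ(u, v). A common zero (u : v) of Fᵢ and Fⱼ
-- modulo p with gcd(u, v) = 1 makes p divide Res(Fᵢ, Fⱼ): if p ∤ v, column operations following
-- Horner's scheme turn the last column of the Sylvester matrix into multiples of Fᵢ(u, v) and
-- Fⱼ(u, v) at the cost of a power of v; if p ∣ v, the first column vanishes modulo p.
-- Since αᵢ is squarefree, divisibility by each of its prime factors suffices.

module Submission where

open import Defs
open import Data.Bool.Base using (true; false; T; if_then_else_)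
open import Data.Empty using (⊥-elim)
open import Data.Fin.Base using (Fin; zero; suc; toℕ; fromℕ<; fromℕ; punchIn; punchOut)
open import Data.Fin.Properties
  using (any?; suc-injective; toℕ<n; toℕ-fromℕ<; toℕ-fromℕ; toℕ-injective;
         punchInᵢ≢i; punchIn-punchOut; punchOut-punchIn; punchOut-cong)
  renaming (_≟_ to _≟F_)
open import Data.Integer.Base using (ℤ; +_; -[1+_]; _+_; _*_; _-_; -_; _^_; 0ℤ; 1ℤ; ∣_∣)
import Data.Integer.Properties as ℤ
open import Data.Integer.DivMod using (_%ℕ_; _/ℕ_; a≡a%ℕn+[a/ℕn]*n; n%ℕd<d)
open import Data.Integer.Divisibility.Signed
open import Data.Integer.Divisibility using () renaming (_∣_ to _∣ᵤ_)
open import Data.Integer.GCD using (gcd; gcd-greatest)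
open import Data.Integer.Tactic.RingSolver using (solve-∀)
open import Data.List.Base using (List; []; _∷_)
open import Data.List.Relation.Unary.All using (_∷_)
open import Data.Nat.Base as ℕ using (ℕ; zero; suc; _∸_; s≤s; z≤n)
import Data.Nat.Properties as ℕ
open import Data.Nat.Coprimality using (Coprime; coprime-Bézout)
open import Data.Nat.Divisibility as ℕ using (divides) renaming (_∣_ to _∣ℕ_)
open import Data.Nat.GCD as ℕ using (module Bézout)
open import Data.Nat.ListAction using (product)
open import Data.Nat.Primality
  using (Prime; euclidsLemma; ¬prime[1]; prime[2]; prime⇒nonZero; prime⇒irreducible)
open import Data.Nat.Primality.Factorisation using (factorise)
open import Data.Product using (Σ; ∃-syntax; _×_; _,_; proj₁; proj₂)
open import Data.Rational using (ℚ) renaming (_*_ to _*ℚ_; _/_ to _/ℚ_)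
open import Data.Sum as Sum using (_⊎_; inj₁; inj₂)
open import Function.Base using (_∘_)
open import Relation.Nullary using (¬_; yes; no)
open import Relation.Nullary.Decidable using (_×-dec_; ¬?)
open import Relation.Binary.PropositionalEquality

-- Primes and squarefree integers

prime∤1 : ∀ {p} → Prime p → ¬ (+ p ∣ 1ℤ)
prime∤1 p-prime p∣1 with ℕ.∣1⇒≡1 (∣⇒∣ᵤ p∣1)
... | refl = ¬prime[1] p-prime

prime-∣-* : ∀ {p} → Prime p → ∀ a b → + p ∣ a * b → (+ p ∣ a) ⊎ (+ p ∣ b)
prime-∣-* p-prime a b p∣ab = Sum.map ∣ᵤ⇒∣ ∣ᵤ⇒∣
  (euclidsLemma ∣ a ∣ ∣ b ∣ p-prime (subst (_ ∣ℕ_) (ℤ.abs-* a b) (∣⇒∣ᵤ p∣ab)))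

prime-∣-square : ∀ {p} → Prime p → ∀ a → + p ∣ a * a → + p ∣ a
prime-∣-square p-prime a p∣aa = Sum.reduce (prime-∣-* p-prime a a p∣aa)

prime∤-* : ∀ {p a b} → Prime p → ¬ (+ p ∣ a) → ¬ (+ p ∣ b) → ¬ (+ p ∣ a * b)
prime∤-* {a = a} {b} p-prime p∤a p∤b p∣ab = Sum.[ p∤a , p∤b ] (prime-∣-* p-prime a b p∣ab)

prime-∣-cancelˡ : ∀ {p a} b → Prime p → ¬ (+ p ∣ a) → + p ∣ a * b → + p ∣ b
prime-∣-cancelˡ {a = a} b p-prime p∤a p∣ab with prime-∣-* p-prime a b p∣ab
... | inj₁ p∣a = ⊥-elim (p∤a p∣a)
... | inj₂ p∣b = p∣b

prime∤-^ : ∀ {p v} → Prime p → ¬ (+ p ∣ v) → ∀ e → ¬ (+ p ∣ v ^ e)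
prime∤-^ p-prime p∤v zero    = prime∤1 p-prime
prime∤-^ p-prime p∤v (suc e) = prime∤-* p-prime p∤v (prime∤-^ p-prime p∤v e)

∣gcd : ∀ {d a b} → d ∣ a → d ∣ b → d ∣ gcd a b
∣gcd {d} {a} {b} d∣a d∣b = ∣ᵤ⇒∣ (gcd-greatest {a} {b} {d} (∣⇒∣ᵤ d∣a) (∣⇒∣ᵤ d∣b))

prime∤-coprime : ∀ {p a b} → Prime p → gcd a b ≡ 1ℤ → + p ∣ a → ¬ (+ p ∣ b)
prime∤-coprime {p} p-prime gcd≡1 p∣a p∣b = prime∤1 p-prime (subst (+ p ∣_) gcd≡1 (∣gcd p∣a p∣b))

squarefree⇒∤cofactor : ∀ {p a b} → Prime p → Squarefree a → a ≡ b * + p → ¬ (+ p ∣ b)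
squarefree⇒∤cofactor {p} {a} {b} p-prime (_ , sq) a≡bp (divides c b≡cp) =
  ¬prime[1] (subst Prime (sq p (divides ∣ c ∣ ∣a∣≡∣c∣pp)) p-prime)
  where
  ∣a∣≡∣c∣pp : ∣ a ∣ ≡ ∣ c ∣ ℕ.* (p ℕ.* p)
  ∣a∣≡∣c∣pp = begin
    ∣ a ∣                      ≡⟨ cong ∣_∣ (trans a≡bp (cong (_* + p) b≡cp)) ⟩
    ∣ c * + p * + p ∣          ≡⟨ ℤ.abs-* (c * + p) (+ p) ⟩
    ∣ c * + p ∣ ℕ.* p          ≡⟨ cong (ℕ._* p) (ℤ.abs-* c (+ p)) ⟩
    ∣ c ∣ ℕ.* p ℕ.* p          ≡⟨ ℕ.*-assoc ∣ c ∣ p p ⟩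
    ∣ c ∣ ℕ.* (p ℕ.* p)        ∎
    where open ≡-Reasoning

prime-divisor : ∀ {n} → 1 ℕ.< n → ∃[ p ] Prime p × p ∣ℕ n
prime-divisor {n@(suc _)} 1<n with factorise n
... | record { factors = [] ; isFactorisation = n≡1 } = ⊥-elim (ℕ.<⇒≢ 1<n (sym n≡1))
... | record { factors = p ∷ ps ; isFactorisation = n≡p*ps ; factorsPrime = p-prime ∷ _ } =
  p , p-prime , divides (product ps) (trans n≡p*ps (ℕ.*-comm p (product ps)))

-- Write ∣a∣ = b · gcd(∣a∣, N); a prime factor q of b also divides gcd(∣a∣, N), so q² ∣ a.
squarefree-∣ : ∀ {a} N → Squarefree a → (∀ p → Prime p → p ∣ℕ ∣ a ∣ → p ∣ℕ N) → ∣ a ∣ ∣ℕ N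
squarefree-∣ {a} N (a≢0 , sq) primes∣N with ℕ.gcd[m,n]∣m ∣ a ∣ N
... | divides zero ∣a∣≡0 = ⊥-elim (a≢0 (ℤ.∣i∣≡0⇒i≡0 ∣a∣≡0))
... | divides 1 ∣a∣≡g = subst (_∣ℕ N) (sym (trans ∣a∣≡g (ℕ.*-identityˡ _))) (ℕ.gcd[m,n]∣n ∣ a ∣ N)
... | divides b@(suc (suc _)) ∣a∣≡bg with prime-divisor {b} (s≤s (s≤s z≤n))
...   | q , q-prime , q∣b = ⊥-elim (¬prime[1] (subst Prime (sq q qq∣a) q-prime))
  where
  q∣a : q ∣ℕ ∣ a ∣
  q∣a = ℕ.∣-trans q∣b (divides (ℕ.gcd ∣ a ∣ N) (trans ∣a∣≡bg (ℕ.*-comm b (ℕ.gcd ∣ a ∣ N))))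
  qq∣a : q ℕ.* q ∣ℕ ∣ a ∣
  qq∣a = subst (q ℕ.* q ∣ℕ_) (sym ∣a∣≡bg)
           (ℕ.*-pres-∣ q∣b (ℕ.gcd-greatest q∣a (primes∣N q q-prime q∣a)))

prodFin-∤ : ∀ {p} → Prime p → ∀ r (g : Fin r → ℤ) → (∀ j → ¬ (+ p ∣ g j)) → ¬ (+ p ∣ prodFin r g)
prodFin-∤ p-prime zero    g p∤g = prime∤1 p-prime
prodFin-∤ p-prime (suc r) g p∤g =
  prime∤-* p-prime (p∤g zero) (prodFin-∤ p-prime r (g ∘ suc) (p∤g ∘ suc))

prodFin-extract : ∀ {p} → Prime p → ∀ r (g : Fin r → ℤ) i → (∀ j → j ≢ i → ¬ (+ p ∣ g j)) →
                  ∃[ c ] prodFin r g ≡ g i * c × ¬ (+ p ∣ c)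
prodFin-extract p-prime (suc r) g zero p∤g =
  prodFin r (g ∘ suc) , refl , prodFin-∤ p-prime r (g ∘ suc) (λ j → p∤g (suc j) λ ())
prodFin-extract p-prime (suc r) g (suc i) p∤g
  with prodFin-extract p-prime r (g ∘ suc) i (λ j j≢i → p∤g (suc j) (j≢i ∘ suc-injective))
... | c , ∏≡g[i]*c , p∤c =
  g zero * c , trans (cong (g zero *_) ∏≡g[i]*c) (x[yz]≡y[xz] (g zero) (g (suc i)) c) ,
  prime∤-* p-prime (p∤g zero λ ()) p∤c
  where
  x[yz]≡y[xz] : ∀ x y z → x * (y * z) ≡ y * (x * z)
  x[yz]≡y[xz] = solve-∀

prodFin-∣ : ∀ {d} r (g : Fin r → ℤ) j → d ∣ g j → d ∣ prodFin r g
prodFin-∣ (suc r) g zero    d∣g₀ = ∣m⇒∣m*n _ d∣g₀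
prodFin-∣ (suc r) g (suc j) d∣gⱼ = ∣n⇒∣m*n (g zero) (prodFin-∣ r (g ∘ suc) j d∣gⱼ)

prodExcept-∣ : ∀ {d} r i (g : Fin r → ℤ) j → i ≢ j → d ∣ g j → d ∣ prodExcept r i g
prodExcept-∣ {d} r i g j i≢j d∣gⱼ = prodFin-∣ r (proj₁ unfolded) j factor-∣
  where
  -- prodExcept keeps its factor function local; unfolded gives it a name.
  unfolded : ∃[ h ] prodExcept r i g ≡ prodFin r h
  unfolded = _ , refl
  factor-∣ : d ∣ proj₁ unfolded j
  factor-∣ with i ≟F j
  ... | yes i≡j = ⊥-elim (i≢j i≡j)
  ... | no  _   = d∣gⱼ

squarefree*∤⇒¬square : ∀ {p a c} → Prime p → Squarefree a → + p ∣ a → ¬ (+ p ∣ c) →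
                       ¬ IsSquare (a * c)
squarefree*∤⇒¬square {p} {a} {c} p-prime a-sf (divides a₁ a≡a₁p) p∤c (s , ac≡ss) =
  p∤s (prime-∣-square p-prime s (divides (a₁ * c) ss≡a₁cp))
  where
  open ≡-Reasoning
  ss≡a₁cp : s * s ≡ a₁ * c * + p
  ss≡a₁cp = begin
    s * s            ≡⟨ sym ac≡ss ⟩
    a * c            ≡⟨ cong (_* c) a≡a₁p ⟩
    a₁ * + p * c     ≡⟨ ring a₁ (+ p) c ⟩
    a₁ * c * + p     ∎
    where ring : ∀ a b c → a * b * c ≡ a * c * b
          ring = solve-∀
  p∤s : ¬ (+ p ∣ s)
  p∤s (divides s₁ s≡s₁p) = squarefree⇒∤cofactor p-prime a-sf a≡a₁p
    (prime-∣-cancelˡ a₁ p-prime p∤c (divides (s₁ * s₁) (ℤ.*-cancelˡ-≡ (+ p) _ _ {{prime⇒nonZero p-prime}} (begin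
      + p * (c * a₁)          ≡⟨ ring₁ (+ p) c a₁ ⟩
      a₁ * c * + p            ≡⟨ sym ss≡a₁cp ⟩
      s * s                   ≡⟨ cong₂ _*_ s≡s₁p s≡s₁p ⟩
      s₁ * + p * (s₁ * + p)   ≡⟨ ring₂ s₁ (+ p) ⟩
      + p * (s₁ * s₁ * + p)   ∎))))
    where ring₁ : ∀ p c a → p * (c * a) ≡ a * c * p
          ring₁ = solve-∀
          ring₂ : ∀ s p → s * p * (s * p) ≡ p * (s * s * p)
          ring₂ = solve-∀

square-product⇒∣-another : ∀ {p} → Prime p → ∀ r (α : Fin r → ℤ) → (∀ j → Squarefree (α j)) →
                           IsSquare (prodFin r α) → ∀ i → + p ∣ α i → ∃[ j ] j ≢ i × + p ∣ α j
square-product⇒∣-another {p} p-prime r α α-sf square i p∣αᵢ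
  with any? (λ j → ¬? (j ≟F i) ×-dec (+ p ∣? α j))
... | yes found = found
... | no none with prodFin-extract p-prime r α i (λ j j≢i p∣αⱼ → none (j , j≢i , p∣αⱼ))
...   | c , ∏≡αᵢ*c , p∤c =
  ⊥-elim (squarefree*∤⇒¬square p-prime (α-sf i) p∣αᵢ p∤c (subst IsSquare ∏≡αᵢ*c square))

-- Inert primes

odd≢even : ∀ a b → + 2 * a + 1ℤ ≢ + 2 * b
odd≢even a b 2a+1≡2b = prime∤1 prime[2]
  (∣m+n∣m⇒∣n (subst (+ 2 ∣_) (sym 2a+1≡2b) (∣m⇒∣m*n b ∣-refl)) (∣m⇒∣m*n a ∣-refl))

parity : ∀ x → ∃[ a ] (x ≡ + 2 * a ⊎ x ≡ + 2 * a + 1ℤ)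
parity x with x %ℕ 2 | n%ℕd<d x 2 | a≡a%ℕn+[a/ℕn]*n x 2
... | 0 | _ | x≡0+q*2 = x /ℕ 2 , inj₁ (trans x≡0+q*2 (ring (x /ℕ 2)))
  where ring : ∀ q → + 0 + q * + 2 ≡ + 2 * q
        ring = solve-∀
... | 1 | _ | x≡1+q*2 = x /ℕ 2 , inj₂ (trans x≡1+q*2 (ring (x /ℕ 2)))
  where ring : ∀ q → + 1 + q * + 2 ≡ + 2 * q + 1ℤ
        ring = solve-∀
... | suc (suc _) | s≤s (s≤s ()) | _

odd-square : ∀ a → ∃[ m ] (+ 2 * a + 1ℤ) * (+ 2 * a + 1ℤ) ≡ + 8 * m + 1ℤ
odd-square a with parity a
... | b , inj₁ refl = + 2 * b * b + b , ring b
  where ring : ∀ b → (+ 2 * (+ 2 * b) + 1ℤ) * (+ 2 * (+ 2 * b) + 1ℤ) ≡ + 8 * (+ 2 * b * b + b) + 1ℤ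
        ring = solve-∀
... | b , inj₂ refl = + 2 * b * b + + 3 * b + 1ℤ , ring b
  where ring : ∀ b → (+ 2 * (+ 2 * b + 1ℤ) + 1ℤ) * (+ 2 * (+ 2 * b + 1ℤ) + 1ℤ)
                     ≡ + 8 * (+ 2 * b * b + + 3 * b + 1ℤ) + 1ℤ
        ring = solve-∀

norm : ℤ → ℤ → ℤ → ℤ
norm Δ x y = x * x + Δ * (y * y)

-- Not simply p ∣ x² + Δy² ⇒ p ∣ x, y: that fails for p = 2 and Δ ≡ 3 (mod 8) (1 + 3 = 4),
-- but there 2 still cannot divide x² + Δy² exactly once up to squares.
Inert : ℤ → ℕ → Set
Inert Δ p = ∀ x y t c → ¬ (+ p ∣ c) → norm Δ x y ≡ + p * c * (t * t) → (+ p ∣ x) × (+ p ∣ y)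

twice-odd*square≢4*odd : ∀ γ t M → + 2 * (+ 2 * γ + 1ℤ) * (t * t) ≢ + 4 * (+ 2 * M + 1ℤ)
twice-odd*square≢4*odd γ t M eq with parity t
... | τ , inj₁ refl = odd≢even M ((+ 2 * γ + 1ℤ) * τ * τ)
  (sym (ℤ.*-cancelˡ-≡ (+ 4) _ _ (trans (ring γ τ) eq)))
  where ring : ∀ γ τ → + 4 * (+ 2 * ((+ 2 * γ + 1ℤ) * τ * τ)) ≡ + 2 * (+ 2 * γ + 1ℤ) * ((+ 2 * τ) * (+ 2 * τ))
        ring = solve-∀
... | τ , inj₂ refl with odd-square τ
...   | m , t²≡8m+1 = odd≢even (+ 8 * γ * m + γ + + 4 * m) (+ 2 * M + 1ℤ)
  (ℤ.*-cancelˡ-≡ (+ 2) _ _ (begin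
    + 2 * (+ 2 * (+ 8 * γ * m + γ + + 4 * m) + 1ℤ)  ≡⟨ ring₁ γ m ⟩
    + 2 * (+ 2 * γ + 1ℤ) * (+ 8 * m + 1ℤ)          ≡⟨ cong (+ 2 * (+ 2 * γ + 1ℤ) *_) (sym t²≡8m+1) ⟩
    + 2 * (+ 2 * γ + 1ℤ) * ((+ 2 * τ + 1ℤ) * (+ 2 * τ + 1ℤ)) ≡⟨ eq ⟩
    + 4 * (+ 2 * M + 1ℤ)                           ≡⟨ ring₂ M ⟩
    + 2 * (+ 2 * (+ 2 * M + 1ℤ))                   ∎))
  where open ≡-Reasoning
        ring₁ : ∀ γ m → + 2 * (+ 2 * (+ 8 * γ * m + γ + + 4 * m) + 1ℤ) ≡ + 2 * (+ 2 * γ + 1ℤ) * (+ 8 * m + 1ℤ)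
        ring₁ = solve-∀
        ring₂ : ∀ M → + 4 * (+ 2 * M + 1ℤ) ≡ + 2 * (+ 2 * (+ 2 * M + 1ℤ))
        ring₂ = solve-∀

Δ≡3[8]⇒Inert[2] : ∀ k → Inert (+ 8 * k + + 3) 2
Δ≡3[8]⇒Inert[2] k x y t c 2∤c eq with parity x | parity y
... | a , inj₁ refl | b , inj₁ refl = ∣m⇒∣m*n a ∣-refl , ∣m⇒∣m*n b ∣-refl
... | a , inj₂ refl | b , inj₁ refl =
  ⊥-elim (odd≢even (+ 2 * a * a + + 2 * a + + 2 * (+ 8 * k + + 3) * b * b) (c * (t * t))
    (trans (ring a b k) (trans eq (ℤ.*-assoc (+ 2) c (t * t)))))
  where ring : ∀ a b k → + 2 * (+ 2 * a * a + + 2 * a + + 2 * (+ 8 * k + + 3) * b * b) + 1ℤ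
                         ≡ (+ 2 * a + 1ℤ) * (+ 2 * a + 1ℤ) + (+ 8 * k + + 3) * ((+ 2 * b) * (+ 2 * b))
        ring = solve-∀
... | a , inj₁ refl | b , inj₂ refl =
  ⊥-elim (odd≢even (+ 2 * a * a + (+ 8 * k + + 3) * (+ 2 * b * b + + 2 * b) + + 4 * k + 1ℤ) (c * (t * t))
    (trans (ring a b k) (trans eq (ℤ.*-assoc (+ 2) c (t * t)))))
  where ring : ∀ a b k → + 2 * (+ 2 * a * a + (+ 8 * k + + 3) * (+ 2 * b * b + + 2 * b) + + 4 * k + 1ℤ) + 1ℤ
                         ≡ (+ 2 * a) * (+ 2 * a) + (+ 8 * k + + 3) * ((+ 2 * b + 1ℤ) * (+ 2 * b + 1ℤ))
        ring = solve-∀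
... | a , inj₂ refl | b , inj₂ refl with odd-square a | odd-square b | parity c
...   | _ | _ | γ , inj₁ refl = ⊥-elim (2∤c (∣m⇒∣m*n γ ∣-refl))
...   | m₁ , x²≡8m₁+1 | m₂ , y²≡8m₂+1 | γ , inj₂ refl =
  ⊥-elim (twice-odd*square≢4*odd γ t (m₁ + + 8 * k * m₂ + + 3 * m₂ + k) (begin
    + 2 * (+ 2 * γ + 1ℤ) * (t * t)                   ≡⟨ sym eq ⟩
    norm (+ 8 * k + + 3) (+ 2 * a + 1ℤ) (+ 2 * b + 1ℤ) ≡⟨ cong₂ (λ u w → u + (+ 8 * k + + 3) * w) x²≡8m₁+1 y²≡8m₂+1 ⟩
    + 8 * m₁ + 1ℤ + (+ 8 * k + + 3) * (+ 8 * m₂ + 1ℤ) ≡⟨ ring m₁ m₂ k ⟩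
    + 4 * (+ 2 * (m₁ + + 8 * k * m₂ + + 3 * m₂ + k) + 1ℤ) ∎))
  where open ≡-Reasoning
        ring : ∀ m₁ m₂ k → + 8 * m₁ + 1ℤ + (+ 8 * k + + 3) * (+ 8 * m₂ + 1ℤ)
                           ≡ + 4 * (+ 2 * (m₁ + + 8 * k * m₂ + + 3 * m₂ + k) + 1ℤ)
        ring = solve-∀

discK-cases : ∀ Δ → ((- Δ) %ℕ 4 ≡ 1 × discK Δ ≡ - Δ) ⊎ discK Δ ≡ + 4 * (- Δ)
discK-cases Δ with ((- Δ) %ℕ 4) ℕ.≡ᵇ 1 in eq
... | true  = inj₁ (ℕ.≡ᵇ⇒≡ _ 1 (subst T (sym eq) _) , refl)
... | false = inj₂ refl

a%ℕn≡r⇒a≡r+[a/ℕn]*n : ∀ a n .{{_ : ℕ.NonZero n}} {r} → a %ℕ n ≡ r → a ≡ + r + (a /ℕ n) * + n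
a%ℕn≡r⇒a≡r+[a/ℕn]*n a n refl = a≡a%ℕn+[a/ℕn]*n a n

discK≡±3[8]⇒Δ≡3[8] : ∀ Δ → (discK Δ %ℕ 8 ≡ 3) ⊎ (discK Δ %ℕ 8 ≡ 5) → ∃[ k ] Δ ≡ + 8 * k + + 3
discK≡±3[8]⇒Δ≡3[8] Δ d%8 with discK-cases Δ | d%8
... | inj₂ d≡4[-Δ] | inj₁ d%8≡3 = ⊥-elim (odd≢even (+ 1 + + 4 * q) (+ 2 * (- Δ)) (begin
  + 2 * (+ 1 + + 4 * q) + 1ℤ  ≡⟨ ring q ⟩
  + 3 + q * + 8               ≡⟨ sym (a%ℕn≡r⇒a≡r+[a/ℕn]*n (discK Δ) 8 d%8≡3) ⟩
  discK Δ                     ≡⟨ d≡4[-Δ] ⟩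
  + 4 * (- Δ)                 ≡⟨ ring₄ (- Δ) ⟩
  + 2 * (+ 2 * (- Δ))         ∎))
  where open ≡-Reasoning
        q = discK Δ /ℕ 8
        ring : ∀ q → + 2 * (+ 1 + + 4 * q) + 1ℤ ≡ + 3 + q * + 8
        ring = solve-∀
        ring₄ : ∀ n → + 4 * n ≡ + 2 * (+ 2 * n)
        ring₄ = solve-∀
... | inj₂ d≡4[-Δ] | inj₂ d%8≡5 = ⊥-elim (odd≢even (+ 2 + + 4 * q) (+ 2 * (- Δ)) (begin
  + 2 * (+ 2 + + 4 * q) + 1ℤ  ≡⟨ ring q ⟩
  + 5 + q * + 8               ≡⟨ sym (a%ℕn≡r⇒a≡r+[a/ℕn]*n (discK Δ) 8 d%8≡5) ⟩
  discK Δ                     ≡⟨ d≡4[-Δ] ⟩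
  + 4 * (- Δ)                 ≡⟨ ring₄ (- Δ) ⟩
  + 2 * (+ 2 * (- Δ))         ∎))
  where open ≡-Reasoning
        q = discK Δ /ℕ 8
        ring : ∀ q → + 2 * (+ 2 + + 4 * q) + 1ℤ ≡ + 5 + q * + 8
        ring = solve-∀
        ring₄ : ∀ n → + 4 * n ≡ + 2 * (+ 2 * n)
        ring₄ = solve-∀
... | inj₁ (-Δ%4≡1 , d≡-Δ) | inj₁ d%8≡3 = ⊥-elim (odd≢even (+ 2 * q) a (sym (ℤ.*-cancelˡ-≡ (+ 2) _ _ (begin
  + 2 * (+ 2 * a)             ≡⟨ ring₁ a ⟩
  + 1 + a * + 4 - 1ℤ          ≡⟨ cong (_- 1ℤ) (sym (a%ℕn≡r⇒a≡r+[a/ℕn]*n (- Δ) 4 -Δ%4≡1)) ⟩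
  - Δ - 1ℤ                    ≡⟨ cong (_- 1ℤ) (trans (sym d≡-Δ) (a%ℕn≡r⇒a≡r+[a/ℕn]*n (discK Δ) 8 d%8≡3)) ⟩
  + 3 + q * + 8 - 1ℤ          ≡⟨ ring₂ q ⟩
  + 2 * (+ 2 * (+ 2 * q) + 1ℤ) ∎))))
  where open ≡-Reasoning
        q = discK Δ /ℕ 8
        a = - Δ /ℕ 4
        ring₁ : ∀ a → + 2 * (+ 2 * a) ≡ + 1 + a * + 4 - 1ℤ
        ring₁ = solve-∀
        ring₂ : ∀ q → + 3 + q * + 8 - 1ℤ ≡ + 2 * (+ 2 * (+ 2 * q) + 1ℤ)
        ring₂ = solve-∀
... | inj₁ (_ , d≡-Δ) | inj₂ d%8≡5 = - q - 1ℤ , (begin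
  Δ                           ≡⟨ sym (ℤ.neg-involutive Δ) ⟩
  - (- Δ)                     ≡⟨ cong -_ (trans (sym d≡-Δ) (a%ℕn≡r⇒a≡r+[a/ℕn]*n (discK Δ) 8 d%8≡5)) ⟩
  - (+ 5 + q * + 8)           ≡⟨ ring q ⟩
  + 8 * (- q - 1ℤ) + + 3      ∎)
  where open ≡-Reasoning
        q = discK Δ /ℕ 8
        ring : ∀ q → - (+ 5 + q * + 8) ≡ + 8 * (- q - 1ℤ) + + 3
        ring = solve-∀

prime∤⇒coprime : ∀ {p n} → Prime p → ¬ (p ∣ℕ n) → Coprime p n
prime∤⇒coprime p-prime p∤n (d∣p , d∣n) with prime⇒irreducible p-prime d∣p
... | inj₁ d≡1 = d≡1
... | inj₂ refl = ⊥-elim (p∤n d∣n)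

∣i∣*∣i∣≡i*i : ∀ i → + ∣ i ∣ * + ∣ i ∣ ≡ i * i
∣i∣*∣i∣≡i*i (+ n)    = refl
∣i∣*∣i∣≡i*i -[1+ n ] = refl

-- Bézout's identity for p and n in ℕ gives n b ≡ ±1 (mod p).
bézout-mod : ∀ {p n} → Coprime p n → ∃[ b ] + p ∣ (+ n * + b - 1ℤ) * (+ n * + b + 1ℤ)
bézout-mod {p} {n} p⊥n with coprime-Bézout p⊥n
... | Bézout.+- a b 1+bn≡ap = b , ∣n⇒∣m*n (+ n * + b - 1ℤ) (divides (+ a) (begin
  + n * + b + 1ℤ         ≡⟨ ring (+ n) (+ b) ⟩
  1ℤ + + b * + n         ≡⟨ cong (λ m → 1ℤ + m) (sym (ℤ.pos-* b n)) ⟩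
  1ℤ + + (b ℕ.* n)       ≡⟨ cong +_ 1+bn≡ap ⟩
  + (a ℕ.* p)            ≡⟨ ℤ.pos-* a p ⟩
  + a * + p              ∎))
  where open ≡-Reasoning
        ring : ∀ n b → n * b + 1ℤ ≡ 1ℤ + b * n
        ring = solve-∀
... | Bézout.-+ a b 1+ap≡bn = b , ∣m⇒∣m*n (+ n * + b + 1ℤ) (divides (+ a) (begin
  + n * + b - 1ℤ         ≡⟨ cong (_- 1ℤ) (trans (ℤ.*-comm (+ n) (+ b)) (sym (ℤ.pos-* b n))) ⟩
  + (b ℕ.* n) - 1ℤ       ≡⟨ cong (λ m → + m - 1ℤ) (sym 1+ap≡bn) ⟩
  1ℤ + + (a ℕ.* p) - 1ℤ  ≡⟨ ring (+ (a ℕ.* p)) ⟩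
  + (a ℕ.* p)            ≡⟨ ℤ.pos-* a p ⟩
  + a * + p              ∎))
  where open ≡-Reasoning
        ring : ∀ m → 1ℤ + m - 1ℤ ≡ m
        ring = solve-∀

inverse-mod-prime : ∀ {p} → Prime p → ∀ y → ¬ (+ p ∣ y) → ∃[ z ] + p ∣ y * z - 1ℤ
inverse-mod-prime p-prime y p∤y with bézout-mod (prime∤⇒coprime p-prime (p∤y ∘ ∣ᵤ⇒∣))
... | b , p∣[nb]²-1 = y * (+ b * + b) , subst (_ ∣_) (begin
  (+ ∣ y ∣ * + b - 1ℤ) * (+ ∣ y ∣ * + b + 1ℤ) ≡⟨ ring₁ (+ ∣ y ∣) (+ b) ⟩
  + ∣ y ∣ * + ∣ y ∣ * (+ b * + b) - 1ℤ         ≡⟨ cong (λ m → m * (+ b * + b) - 1ℤ) (∣i∣*∣i∣≡i*i y) ⟩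
  y * y * (+ b * + b) - 1ℤ                     ≡⟨ ring₂ y (+ b) ⟩
  y * (y * (+ b * + b)) - 1ℤ                   ∎) p∣[nb]²-1
  where open ≡-Reasoning
        ring₁ : ∀ n b → (n * b - 1ℤ) * (n * b + 1ℤ) ≡ n * n * (b * b) - 1ℤ
        ring₁ = solve-∀
        ring₂ : ∀ y b → y * y * (b * b) - 1ℤ ≡ y * (y * (b * b)) - 1ℤ
        ring₂ = solve-∀

square-mod-discK : ∀ {p} Δ X → + p ∣ X * X - (- Δ) → ∃[ Y ] + p ∣ᵤ Y * Y - discK Δ
square-mod-discK {p} Δ X p∣X²+Δ with discK-cases Δ
... | inj₁ (_ , d≡-Δ) = X , ∣⇒∣ᵤ (subst (λ d → + p ∣ X * X - d) (sym d≡-Δ) p∣X²+Δ)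
... | inj₂ d≡4[-Δ] = + 2 * X , ∣⇒∣ᵤ (subst (λ d → + p ∣ (+ 2 * X) * (+ 2 * X) - d) (sym d≡4[-Δ])
                                      (subst (+ p ∣_) (ring X (- Δ)) (∣n⇒∣m*n (+ 4) p∣X²+Δ)))
  where ring : ∀ X m → + 4 * (X * X - m) ≡ (+ 2 * X) * (+ 2 * X) - + 4 * m
        ring = solve-∀

inert-odd : ∀ {p} Δ → Prime p → ¬ (∃[ Y ] + p ∣ᵤ Y * Y - discK Δ) →
            ∀ x y → + p ∣ norm Δ x y → (+ p ∣ x) × (+ p ∣ y)
inert-odd {p} Δ p-prime nonsquare x y p∣N with + p ∣? y
... | yes p∣y = prime-∣-square p-prime x p∣xx , p∣y
  where p∣Δyy : + p ∣ Δ * (y * y)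
        p∣Δyy = ∣n⇒∣m*n Δ (∣m⇒∣m*n y p∣y)
        p∣xx : + p ∣ x * x
        p∣xx = ∣m+n∣n⇒∣m {+ p} {x * x} {Δ * (y * y)} p∣N p∣Δyy
... | no p∤y = ⊥-elim (nonsquare (square-mod-discK Δ (x * z) p∣[xz]²+Δ))
  where
  z = proj₁ (inverse-mod-prime p-prime y p∤y)
  p∣yz-1 : + p ∣ y * z - 1ℤ
  p∣yz-1 = proj₂ (inverse-mod-prime p-prime y p∤y)
  p∣zzN : + p ∣ z * z * norm Δ x y
  p∣zzN = ∣n⇒∣m*n (z * z) p∣N
  p∣Δ[yz+1][yz-1] : + p ∣ Δ * (y * z + 1ℤ) * (y * z - 1ℤ)
  p∣Δ[yz+1][yz-1] = ∣n⇒∣m*n (Δ * (y * z + 1ℤ)) p∣yz-1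
  ring : ∀ x y z Δ → z * z * (x * x + Δ * (y * y)) - Δ * (y * z + 1ℤ) * (y * z - 1ℤ)
                     ≡ (x * z) * (x * z) - (- Δ)
  ring = solve-∀
  p∣[xz]²+Δ : + p ∣ (x * z) * (x * z) - (- Δ)
  p∣[xz]²+Δ = subst (+ p ∣_) (ring x y z Δ) (∣m∣n⇒∣m-n {+ p} {z * z * norm Δ x y} p∣zzN p∣Δ[yz+1][yz-1])

χ≡-1⇒Inert : ∀ {p} Δ → Prime p → χ≡-1 Δ p → Inert Δ p
χ≡-1⇒Inert Δ _ (inj₁ (refl , d%8≡±3)) with discK≡±3[8]⇒Δ≡3[8] Δ d%8≡±3
... | k , refl = Δ≡3[8]⇒Inert[2] k
χ≡-1⇒Inert {p} Δ p-prime (inj₂ (_ , _ , nonsquare)) x y t c _ N≡pct² =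
  inert-odd Δ p-prime nonsquare x y (divides (c * (t * t)) (trans N≡pct² (ring (+ p) c (t * t))))
  where ring : ∀ p c s → p * c * s ≡ c * s * p
        ring = solve-∀

∣xy⇒∣t : ∀ {p c} Δ x y t → Prime p → ¬ (+ p ∣ c) → norm Δ x y ≡ + p * c * (t * t) →
         + p ∣ x → + p ∣ y → + p ∣ t
∣xy⇒∣t {p} {c} Δ x y t p-prime p∤c N≡pct² (divides x₁ x≡x₁p) (divides y₁ y≡y₁p) =
  prime-∣-square p-prime t (prime-∣-cancelˡ (t * t) p-prime p∤c
    (divides (norm Δ x₁ y₁) (ℤ.*-cancelˡ-≡ (+ p) _ _ {{prime⇒nonZero p-prime}} (begin
      + p * (c * (t * t))               ≡⟨ sym (ℤ.*-assoc (+ p) c (t * t)) ⟩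
      + p * c * (t * t)                 ≡⟨ sym N≡pct² ⟩
      norm Δ x y                        ≡⟨ cong₂ (norm Δ) x≡x₁p y≡y₁p ⟩
      norm Δ (x₁ * + p) (y₁ * + p)      ≡⟨ ring Δ x₁ y₁ (+ p) ⟩
      + p * (norm Δ x₁ y₁ * + p)        ∎))))
  where open ≡-Reasoning
        ring : ∀ Δ x y p → (x * p) * (x * p) + Δ * ((y * p) * (y * p)) ≡ p * ((x * x + Δ * (y * y)) * p)
        ring = solve-∀

inert-∣-value : ∀ {p a} Δ x y t E → Prime p → Inert Δ p → Squarefree a → + p ∣ a →
                norm Δ x y ≡ a * (t * t) * E → gcd (gcd x y) t ≡ 1ℤ → + p ∣ E
inert-∣-value {p} {a} Δ x y t E p-prime inert a-sf (divides a₁ a≡a₁p) N≡at²E xyt-coprime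
  with + p ∣? E
... | yes p∣E = p∣E
... | no  p∤E = ⊥-elim (prime∤-coprime p-prime xyt-coprime (∣gcd p∣x p∣y)
                                        (∣xy⇒∣t Δ x y t p-prime p∤c N≡pct² p∣x p∣y))
  where
  c = a₁ * E
  p∤c : ¬ (+ p ∣ c)
  p∤c = prime∤-* p-prime (squarefree⇒∤cofactor {b = a₁} p-prime a-sf a≡a₁p) p∤E
  N≡pct² : norm Δ x y ≡ + p * c * (t * t)
  N≡pct² = trans N≡at²E (trans (cong (λ b → b * (t * t) * E) a≡a₁p) (ring a₁ (+ p) (t * t) E))
    where ring : ∀ a p s e → a * p * s * e ≡ p * (a * e) * s
          ring = solve-∀
  p∣x = proj₁ (inert x y t c p∤c N≡pct²)
  p∣y = proj₂ (inert x y t c p∤c N≡pct²)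


-- Determinants

Matrix : ℕ → Set
Matrix n = Fin n → Fin n → ℤ

minor : ∀ {n} → Matrix (suc n) → Fin (suc n) → Matrix n
minor M j r c = M (suc r) (punchIn j c)

sumFin-cong : ∀ n {g h : Fin n → ℤ} → (∀ j → g j ≡ h j) → sumFin n g ≡ sumFin n h
sumFin-cong zero    g≡h = refl
sumFin-cong (suc n) g≡h = cong₂ _+_ (g≡h zero) (sumFin-cong n (g≡h ∘ suc))

sumFin-∣ : ∀ {d} n (g : Fin n → ℤ) → (∀ j → d ∣ g j) → d ∣ sumFin n g
sumFin-∣ zero    g d∣g = divides 0ℤ refl
sumFin-∣ (suc n) g d∣g = ∣m∣n⇒∣m+n (d∣g zero) (sumFin-∣ n (g ∘ suc) (d∣g ∘ suc))

det-cong : ∀ n {M N : Matrix n} → (∀ r c → M r c ≡ N r c) → det n M ≡ det n N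
det-cong zero    M≡N = refl
det-cong (suc n) M≡N = sumFin-cong (suc n) λ j →
  cong₂ (λ m d → alt (toℕ j) * m * d) (M≡N zero j) (det-cong n (λ r c → M≡N (suc r) (punchIn j c)))

det-column-∣ : ∀ {d} n (M : Matrix n) c → (∀ r → d ∣ M r c) → d ∣ det n M
det-column-∣ (suc n) M c d∣Mc = sumFin-∣ (suc n) _ term-∣
  where
  term-∣ : ∀ j → _ ∣ alt (toℕ j) * M zero j * det n (minor M j)
  term-∣ j with j ≟F c
  ... | yes refl = ∣m⇒∣m*n (det n (minor M j)) (∣n⇒∣m*n (alt (toℕ j)) (d∣Mc zero))
  ... | no j≢c = ∣n⇒∣m*n (alt (toℕ j) * M zero j) (det-column-∣ n (minor M j) (punchOut j≢c)
                   λ r → subst (_ ∣_) (cong (M (suc r)) (sym (punchIn-punchOut j≢c))) (d∣Mc (suc r)))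

sumFin-linear : ∀ n (g g₁ g₂ : Fin n → ℤ) μ ν → (∀ j → g j ≡ μ * g₁ j + ν * g₂ j) →
                sumFin n g ≡ μ * sumFin n g₁ + ν * sumFin n g₂
sumFin-linear zero    g g₁ g₂ μ ν g≡ = ring μ ν
  where ring : ∀ μ ν → 0ℤ ≡ μ * 0ℤ + ν * 0ℤ
        ring = solve-∀
sumFin-linear (suc n) g g₁ g₂ μ ν g≡ =
  trans (cong₂ _+_ (g≡ zero) (sumFin-linear n (g ∘ suc) (g₁ ∘ suc) (g₂ ∘ suc) μ ν (g≡ ∘ suc)))
        (ring μ ν (g₁ zero) (g₂ zero) (sumFin n (g₁ ∘ suc)) (sumFin n (g₂ ∘ suc)))
  where ring : ∀ μ ν a b c d → (μ * a + ν * b) + (μ * c + ν * d) ≡ μ * (a + c) + ν * (b + d)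
        ring = solve-∀

det-linear : ∀ n (M A B : Matrix n) c μ ν →
             (∀ r k → k ≢ c → M r k ≡ A r k) → (∀ r k → k ≢ c → M r k ≡ B r k) →
             (∀ r → M r c ≡ μ * A r c + ν * B r c) →
             det n M ≡ μ * det n A + ν * det n B
det-linear (suc n) M A B c μ ν M≈A M≈B Mc≡ = sumFin-linear (suc n) _ _ _ μ ν term
  where
  term : ∀ j → alt (toℕ j) * M zero j * det n (minor M j)
             ≡ μ * (alt (toℕ j) * A zero j * det n (minor A j))
               + ν * (alt (toℕ j) * B zero j * det n (minor B j))
  term j with j ≟F c
  ... | yes refl = begin
    alt (toℕ j) * M zero j * det n (minor M j)
      ≡⟨ cong (λ m → alt (toℕ j) * m * det n (minor M j)) (Mc≡ zero) ⟩
    alt (toℕ j) * (μ * A zero j + ν * B zero j) * det n (minor M j)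
      ≡⟨ ring (alt (toℕ j)) μ ν (A zero j) (B zero j) (det n (minor M j)) ⟩
    μ * (alt (toℕ j) * A zero j * det n (minor M j)) + ν * (alt (toℕ j) * B zero j * det n (minor M j))
      ≡⟨ cong₂ (λ a b → μ * (alt (toℕ j) * A zero j * a) + ν * (alt (toℕ j) * B zero j * b))
               (det-cong n λ r k → M≈A (suc r) _ (punchInᵢ≢i j k))
               (det-cong n λ r k → M≈B (suc r) _ (punchInᵢ≢i j k)) ⟩
    μ * (alt (toℕ j) * A zero j * det n (minor A j)) + ν * (alt (toℕ j) * B zero j * det n (minor B j)) ∎
    where open ≡-Reasoning
          ring : ∀ s μ ν a b d → s * (μ * a + ν * b) * d ≡ μ * (s * a * d) + ν * (s * b * d)
          ring = solve-∀
  ... | no j≢c = begin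
    alt (toℕ j) * M zero j * det n (minor M j)
      ≡⟨ cong (alt (toℕ j) * M zero j *_) minor-linear ⟩
    alt (toℕ j) * M zero j * (μ * det n (minor A j) + ν * det n (minor B j))
      ≡⟨ ring (alt (toℕ j)) (M zero j) μ ν (det n (minor A j)) (det n (minor B j)) ⟩
    μ * (alt (toℕ j) * M zero j * det n (minor A j)) + ν * (alt (toℕ j) * M zero j * det n (minor B j))
      ≡⟨ cong₂ (λ a b → μ * (alt (toℕ j) * a * det n (minor A j)) + ν * (alt (toℕ j) * b * det n (minor B j)))
               (M≈A zero j j≢c) (M≈B zero j j≢c) ⟩
    μ * (alt (toℕ j) * A zero j * det n (minor A j)) + ν * (alt (toℕ j) * B zero j * det n (minor B j)) ∎
    where
    open ≡-Reasoning
    ring : ∀ s m μ ν a b → s * m * (μ * a + ν * b) ≡ μ * (s * m * a) + ν * (s * m * b)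
    ring = solve-∀
    c′ : Fin n
    c′ = punchOut j≢c
    off-c′ : ∀ {k} → k ≢ c′ → punchIn j k ≢ c
    off-c′ k≢c′ jk≡c = k≢c′ (trans (sym (punchOut-punchIn j)) (punchOut-cong j jk≡c))
    at-c′ : ∀ (N : Matrix (suc n)) r → minor N j r c′ ≡ N (suc r) c
    at-c′ N r = cong (N (suc r)) (punchIn-punchOut j≢c)
    minor-linear : det n (minor M j) ≡ μ * det n (minor A j) + ν * det n (minor B j)
    minor-linear = det-linear n (minor M j) (minor A j) (minor B j) c′ μ ν
      (λ r k k≢c′ → M≈A (suc r) _ (off-c′ k≢c′))
      (λ r k k≢c′ → M≈B (suc r) _ (off-c′ k≢c′))
      (λ r → trans (at-c′ M r) (trans (Mc≡ (suc r))
               (sym (cong₂ (λ a b → μ * a + ν * b) (at-c′ A r) (at-c′ B r)))))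

Adjacent : ∀ {n} → Fin n → Fin n → Set
Adjacent a b = toℕ b ≡ suc (toℕ a)

punchIn-adjacent : ∀ {n} (j a b : Fin (suc n)) → Adjacent a b → j ≢ a → j ≢ b →
                   ∃[ a′ ] ∃[ b′ ] punchIn j a′ ≡ a × punchIn j b′ ≡ b × Adjacent a′ b′
punchIn-adjacent zero zero b _ j≢a _ = ⊥-elim (j≢a refl)
punchIn-adjacent zero (suc a) (suc b) a⋖b _ _ = a , b , refl , refl , cong ℕ.pred a⋖b
punchIn-adjacent {suc n} (suc zero) zero (suc zero) _ _ j≢b = ⊥-elim (j≢b refl)
punchIn-adjacent {suc (suc n)} (suc (suc j)) zero (suc zero) _ _ _ = zero , suc zero , refl , refl , refl
punchIn-adjacent {suc n} (suc j) (suc a) (suc b) a⋖b j≢a j≢b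
  with punchIn-adjacent j a b (cong ℕ.pred a⋖b) (j≢a ∘ cong suc) (j≢b ∘ cong suc)
... | a′ , b′ , ja′≡a , jb′≡b , a′⋖b′ = suc a′ , suc b′ , cong suc ja′≡a , cong suc jb′≡b , cong suc a′⋖b′

punchIn-adjacent-swap : ∀ {n} (a b : Fin (suc n)) → Adjacent a b → ∀ k →
                        punchIn a k ≡ punchIn b k ⊎ (punchIn a k ≡ b × punchIn b k ≡ a)
punchIn-adjacent-swap zero (suc zero) _ zero = inj₂ (refl , refl)
punchIn-adjacent-swap zero (suc zero) _ (suc k) = inj₁ refl
punchIn-adjacent-swap {suc n} (suc a) (suc b) _ zero = inj₁ refl
punchIn-adjacent-swap {suc n} (suc a) (suc b) a⋖b (suc k) with punchIn-adjacent-swap a b (cong ℕ.pred a⋖b) k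
... | inj₁ ak≡bk = inj₁ (cong suc ak≡bk)
... | inj₂ (ak≡b , bk≡a) = inj₂ (cong suc ak≡b , cong suc bk≡a)

sumFin-zero : ∀ n (g : Fin n → ℤ) → (∀ j → g j ≡ 0ℤ) → sumFin n g ≡ 0ℤ
sumFin-zero zero    g g≡0 = refl
sumFin-zero (suc n) g g≡0 = cong₂ _+_ (g≡0 zero) (sumFin-zero n (g ∘ suc) (g≡0 ∘ suc))

sumFin-adjacent : ∀ n (g : Fin n → ℤ) a b → Adjacent a b → (∀ j → j ≢ a → j ≢ b → g j ≡ 0ℤ) →
                  g a + g b ≡ 0ℤ → sumFin n g ≡ 0ℤ
sumFin-adjacent (suc (suc n)) g zero (suc zero) _ rest≡0 ga+gb≡0 = begin
  g zero + (g (suc zero) + sumFin n (λ j → g (suc (suc j))))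
    ≡⟨ cong (λ s → g zero + (g (suc zero) + s)) (sumFin-zero n _ λ j → rest≡0 (suc (suc j)) (λ ()) (λ ())) ⟩
  g zero + (g (suc zero) + 0ℤ)
    ≡⟨ cong (λ s → g zero + s) (ℤ.+-identityʳ _) ⟩
  g zero + g (suc zero)
    ≡⟨ ga+gb≡0 ⟩
  0ℤ ∎
  where open ≡-Reasoning
sumFin-adjacent (suc n) g (suc a) (suc b) a⋖b rest≡0 ga+gb≡0 =
  cong₂ _+_ (rest≡0 zero (λ ()) (λ ()))
    (sumFin-adjacent n (g ∘ suc) a b (cong ℕ.pred a⋖b)
      (λ j j≢a j≢b → rest≡0 (suc j) (j≢a ∘ suc-injective) (j≢b ∘ suc-injective)) ga+gb≡0)

-- Expanding along the first row, the two terms at the equal columns cancel (their minors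
-- coincide and their signs are opposite) and every other minor again has adjacent equal columns.
det-adjacent-columns : ∀ n (M : Matrix n) a b → Adjacent a b → (∀ r → M r a ≡ M r b) → det n M ≡ 0ℤ
det-adjacent-columns (suc n) M a b a⋖b Ma≡Mb = sumFin-adjacent (suc n) _ a b a⋖b other-term≡0 pair≡0
  where
  other-term≡0 : ∀ j → j ≢ a → j ≢ b → alt (toℕ j) * M zero j * det n (minor M j) ≡ 0ℤ
  other-term≡0 j j≢a j≢b with punchIn-adjacent j a b a⋖b j≢a j≢b
  ... | a′ , b′ , ja′≡a , jb′≡b , a′⋖b′ =
    trans (cong (alt (toℕ j) * M zero j *_)
            (det-adjacent-columns n (minor M j) a′ b′ a′⋖b′
              λ r → trans (cong (M (suc r)) ja′≡a) (trans (Ma≡Mb (suc r)) (cong (M (suc r)) (sym jb′≡b)))))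
          (ℤ.*-zeroʳ (alt (toℕ j) * M zero j))
  minors≡ : ∀ r k → minor M a r k ≡ minor M b r k
  minors≡ r k with punchIn-adjacent-swap a b a⋖b k
  ... | inj₁ ak≡bk = cong (M (suc r)) ak≡bk
  ... | inj₂ (ak≡b , bk≡a) =
    trans (cong (M (suc r)) ak≡b) (trans (sym (Ma≡Mb (suc r))) (cong (M (suc r)) (sym bk≡a)))
  pair≡0 : alt (toℕ a) * M zero a * det n (minor M a) + alt (toℕ b) * M zero b * det n (minor M b) ≡ 0ℤ
  pair≡0 rewrite a⋖b | Ma≡Mb zero | det-cong n minors≡ = ring (alt (toℕ a)) (M zero b) (det n (minor M b))
    where ring : ∀ s m d → s * m * d + (- s) * m * d ≡ 0ℤ
          ring = solve-∀

-- Horner's scheme and resultants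

horner : (ℕ → ℤ) → ℤ → ℤ → ℕ → ℤ
horner a u v zero    = a 0
horner a u v (suc K) = v ^ suc K * a (suc K) + u * horner a u v K

sumℕ-cong : ∀ K {g h : ℕ → ℤ} → (∀ k → k ℕ.< K → g k ≡ h k) → sumℕ K g ≡ sumℕ K h
sumℕ-cong zero    g≡h = refl
sumℕ-cong (suc K) g≡h = cong₂ _+_ (sumℕ-cong K λ k k<K → g≡h k (ℕ.m<n⇒m<1+n k<K)) (g≡h K ℕ.≤-refl)

sumℕ-*ˡ : ∀ K c (g : ℕ → ℤ) → sumℕ K (λ k → c * g k) ≡ c * sumℕ K g
sumℕ-*ˡ zero    c g = sym (ℤ.*-zeroʳ c)
sumℕ-*ˡ (suc K) c g = trans (cong (_+ c * g K) (sumℕ-*ˡ K c g)) (sym (ℤ.*-distribˡ-+ c (sumℕ K g) (g K)))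

horner-sum : ∀ a u v K → horner a u v K ≡ sumℕ (suc K) (λ k → a k * u ^ (K ∸ k) * v ^ k)
horner-sum a u v zero = ring (a 0)
  where ring : ∀ x → x ≡ 0ℤ + x * 1ℤ * 1ℤ
        ring = solve-∀
horner-sum a u v (suc K) = begin
  v ^ suc K * a (suc K) + u * horner a u v K
    ≡⟨ cong (λ h → v ^ suc K * a (suc K) + u * h) (horner-sum a u v K) ⟩
  v ^ suc K * a (suc K) + u * sumℕ (suc K) g
    ≡⟨ ring (v ^ suc K) (a (suc K)) u (sumℕ (suc K) g) ⟩
  u * sumℕ (suc K) g + a (suc K) * 1ℤ * v ^ suc K
    ≡⟨ cong (_+ a (suc K) * 1ℤ * v ^ suc K) (sym (sumℕ-*ˡ (suc K) u g)) ⟩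
  sumℕ (suc K) (λ k → u * g k) + a (suc K) * 1ℤ * v ^ suc K
    ≡⟨ cong₂ _+_ (sumℕ-cong (suc K) λ k k≤K →
                   trans (ring₁ u (a k) (u ^ (K ∸ k)) (v ^ k))
                         (cong (λ e → a k * u ^ e * v ^ k) (sym (ℕ.+-∸-assoc 1 (ℕ.≤-pred k≤K)))))
                 (cong (λ e → a (suc K) * u ^ e * v ^ suc K) (sym (ℕ.n∸n≡0 K))) ⟩
  sumℕ (suc (suc K)) (λ k → a k * u ^ (suc K ∸ k) * v ^ k) ∎
  where
  open ≡-Reasoning
  g : ℕ → ℤ
  g k = a k * u ^ (K ∸ k) * v ^ k
  ring : ∀ x y u s → x * y + u * s ≡ u * s + y * 1ℤ * x
  ring = solve-∀
  ring₁ : ∀ u a b c → u * (a * b * c) ≡ a * (u * b) * c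
  ring₁ = solve-∀

horner-mod-v : ∀ a u v K → ∃[ R ] horner a u v K ≡ u ^ K * a 0 + v * R
horner-mod-v a u v zero = 0ℤ , ring (a 0) v
  where ring : ∀ x v → x ≡ 1ℤ * x + v * 0ℤ
        ring = solve-∀
horner-mod-v a u v (suc K) with horner-mod-v a u v K
... | R , h≡ = v ^ K * a (suc K) + u * R ,
  trans (cong (λ h → v ^ suc K * a (suc K) + u * h) h≡) (ring v (v ^ K) (a (suc K)) u (u ^ K) (a 0) R)
  where ring : ∀ v vᴷ x u uᴷ y R → v * vᴷ * x + u * (uᴷ * y + v * R) ≡ u * uᴷ * y + v * (vᴷ * x + u * R)
        ring = solve-∀

horner-pad : ∀ a u v K → (∀ k → K ℕ.< k → a k ≡ 0ℤ) → ∀ e → horner a u v (e ℕ.+ K) ≡ u ^ e * horner a u v K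
horner-pad a u v K _ zero = sym (ℤ.*-identityˡ _)
horner-pad a u v K a>K≡0 (suc e) = begin
  v ^ suc (e ℕ.+ K) * a (suc (e ℕ.+ K)) + u * horner a u v (e ℕ.+ K)
    ≡⟨ cong₂ (λ x h → v ^ suc (e ℕ.+ K) * x + u * h) (a>K≡0 _ (s≤s (ℕ.m≤n+m K e))) (horner-pad a u v K a>K≡0 e) ⟩
  v ^ suc (e ℕ.+ K) * 0ℤ + u * (u ^ e * horner a u v K)
    ≡⟨ ring (v ^ suc (e ℕ.+ K)) u (u ^ e) (horner a u v K) ⟩
  u * u ^ e * horner a u v K ∎
  where open ≡-Reasoning
        ring : ∀ x u w h → x * 0ℤ + u * (w * h) ≡ u * w * h
        ring = solve-∀

shifted-< : ∀ a s k → k ℕ.< s → shifted a s k ≡ 0ℤ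
shifted-< a s k k<s with s ℕ.≤ᵇ k in s≤ᵇk
... | false = refl
... | true  = ⊥-elim (ℕ.<⇒≱ k<s (ℕ.≤ᵇ⇒≤ s k (subst T (sym s≤ᵇk) _)))

shifted-≥ : ∀ a s k → s ℕ.≤ k → shifted a s k ≡ a (k ∸ s)
shifted-≥ a s k s≤k with s ℕ.≤ᵇ k in s≤ᵇk
... | true  = refl
... | false = ⊥-elim (subst T s≤ᵇk (ℕ.≤⇒≤ᵇ s≤k))

horner-shifted-< : ∀ a u v s j → j ℕ.< s → horner (shifted a s) u v j ≡ 0ℤ
horner-shifted-< a u v s zero    0<s = shifted-< a s 0 0<s
horner-shifted-< a u v s (suc j) j<s =
  trans (cong₂ (λ x h → v ^ suc j * x + u * h) (shifted-< a s (suc j) j<s)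
                                               (horner-shifted-< a u v s j (ℕ.<-trans (ℕ.n<1+n j) j<s)))
        (ring (v ^ suc j) u)
  where ring : ∀ x u → x * 0ℤ + u * 0ℤ ≡ 0ℤ
        ring = solve-∀

horner-shifted : ∀ a u v s K → horner (shifted a s) u v (K ℕ.+ s) ≡ v ^ s * horner a u v K
horner-shifted a u v zero zero = sym (ℤ.*-identityˡ (a 0))
horner-shifted a u v (suc s) zero = begin
  v ^ suc s * shifted a (suc s) (suc s) + u * horner (shifted a (suc s)) u v s
    ≡⟨ cong₂ (λ x h → v ^ suc s * x + u * h) (shifted-≥ a (suc s) (suc s) ℕ.≤-refl)
                                             (horner-shifted-< a u v (suc s) s ℕ.≤-refl) ⟩
  v ^ suc s * a (s ∸ s) + u * 0ℤ
    ≡⟨ cong (λ k → v ^ suc s * a k + u * 0ℤ) (ℕ.n∸n≡0 s) ⟩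
  v ^ suc s * a 0 + u * 0ℤ
    ≡⟨ ring (v ^ suc s) (a 0) u ⟩
  v ^ suc s * a 0 ∎
  where open ≡-Reasoning
        ring : ∀ x y u → x * y + u * 0ℤ ≡ x * y
        ring = solve-∀
horner-shifted a u v s (suc K) = begin
  v ^ suc (K ℕ.+ s) * shifted a s (suc K ℕ.+ s) + u * horner (shifted a s) u v (K ℕ.+ s)
    ≡⟨ cong₂ (λ x h → v ^ suc (K ℕ.+ s) * x + u * h)
             (trans (shifted-≥ a s (suc K ℕ.+ s) (ℕ.m≤n+m s (suc K))) (cong a (ℕ.m+n∸n≡m (suc K) s)))
             (horner-shifted a u v s K) ⟩
  v ^ (suc K ℕ.+ s) * a (suc K) + u * (v ^ s * horner a u v K)
    ≡⟨ cong (λ w → w * a (suc K) + u * (v ^ s * horner a u v K)) (ℤ.^-distribˡ-+-* v (suc K) s) ⟩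
  v ^ suc K * v ^ s * a (suc K) + u * (v ^ s * horner a u v K)
    ≡⟨ ring (v ^ suc K) (v ^ s) (a (suc K)) u (horner a u v K) ⟩
  v ^ s * (v ^ suc K * a (suc K) + u * horner a u v K) ∎
  where open ≡-Reasoning
        ring : ∀ x y z u h → x * y * z + u * (y * h) ≡ y * (x * z + u * h)
        ring = solve-∀

coefAt->deg : ∀ F k → deg F ℕ.< k → coefAt F k ≡ 0ℤ
coefAt->deg F k deg<k with k ℕ.<? suc (deg F)
... | yes k≤deg = ⊥-elim (ℕ.<⇒≱ deg<k (ℕ.≤-pred k≤deg))
... | no  _     = refl

evalF-horner : ∀ F u v → evalF F u v ≡ horner (coefAt F) u v (deg F)
evalF-horner F u v = sym (horner-sum (coefAt F) u v (deg F))

shifted-row-∣ : ∀ {d} H u v s K → deg H ℕ.+ s ℕ.≤ K → d ∣ evalF H u v →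
                d ∣ horner (shifted (coefAt H) s) u v K
shifted-row-∣ {d} H u v s K d+s≤K d∣H = subst (d ∣_) (sym horner≡) (∣n⇒∣m*n (u ^ e) (∣n⇒∣m*n (v ^ s)
                                          (subst (d ∣_) (evalF-horner H u v) d∣H)))
  where
  e = K ∸ (deg H ℕ.+ s)
  zeros : ∀ k → deg H ℕ.+ s ℕ.< k → shifted (coefAt H) s k ≡ 0ℤ
  zeros k d+s<k = trans (shifted-≥ (coefAt H) s k (ℕ.m+n≤o⇒n≤o (deg H) (ℕ.<⇒≤ d+s<k)))
                        (coefAt->deg H (k ∸ s) (ℕ.m+n≤o⇒m≤o∸n (suc (deg H)) d+s<k))
  horner≡ : horner (shifted (coefAt H) s) u v K ≡ u ^ e * (v ^ s * horner (coefAt H) u v (deg H))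
  horner≡ = begin
    horner (shifted (coefAt H) s) u v K
      ≡⟨ cong (horner (shifted (coefAt H) s) u v) (sym (ℕ.m∸n+n≡m d+s≤K)) ⟩
    horner (shifted (coefAt H) s) u v (e ℕ.+ (deg H ℕ.+ s))
      ≡⟨ horner-pad (shifted (coefAt H) s) u v (deg H ℕ.+ s) zeros e ⟩
    u ^ e * horner (shifted (coefAt H) s) u v (deg H ℕ.+ s)
      ≡⟨ cong (u ^ e *_) (horner-shifted (coefAt H) u v s (deg H)) ⟩
    u ^ e * (v ^ s * horner (coefAt H) u v (deg H)) ∎
    where open ≡-Reasoning

-- The column operations C_{k+1} ↦ v^(k+1) C_{k+1} + u C_k, done for k = 0, 1, …, n - 1 in turn,
-- scale the determinant by powers of v and turn each column c into the values horner (S r) u v c;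
-- matrix k is the matrix once the first k of them are done.
module _ {n : ℕ} (S : Fin (suc n) → ℕ → ℤ) (u v : ℤ) where

  private
    rows : Matrix (suc n)
    rows r c = S r (toℕ c)

    entry : ℕ → Fin (suc n) → ℕ → ℤ
    entry k r m with m ℕ.≤? k
    ... | yes _ = horner (S r) u v m
    ... | no  _ = S r m

    entry-≤ : ∀ k r m → m ℕ.≤ k → entry k r m ≡ horner (S r) u v m
    entry-≤ k r m m≤k with m ℕ.≤? k
    ... | yes _ = refl
    ... | no m≰k = ⊥-elim (m≰k m≤k)

    entry-≰ : ∀ k r m → ¬ m ℕ.≤ k → entry k r m ≡ S r m
    entry-≰ k r m m≰k with m ℕ.≤? k
    ... | yes m≤k = ⊥-elim (m≰k m≤k)
    ... | no _ = refl

    matrix : ℕ → Matrix (suc n)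
    matrix k r c = entry k r (toℕ c)

    det-matrix-0 : det (suc n) (matrix 0) ≡ det (suc n) rows
    det-matrix-0 = det-cong (suc n) λ r c → entry-0 r (toℕ c)
      where
      entry-0 : ∀ r m → entry 0 r m ≡ S r m
      entry-0 r zero    = entry-≤ 0 r 0 z≤n
      entry-0 r (suc m) = entry-≰ 0 r (suc m) λ ()

    module Step (k : ℕ) (k+1<N : suc k ℕ.< suc n) where

      c c₋ : Fin (suc n)
      c  = fromℕ< k+1<N
      c₋ = fromℕ< (ℕ.<-trans (ℕ.n<1+n k) k+1<N)

      toℕc : toℕ c ≡ suc k
      toℕc = toℕ-fromℕ< k+1<N

      toℕc₋ : toℕ c₋ ≡ k
      toℕc₋ = toℕ-fromℕ< (ℕ.<-trans (ℕ.n<1+n k) k+1<N)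

      doubled : Matrix (suc n)
      doubled r c′ with toℕ c′ ℕ.≟ suc k
      ... | yes _ = horner (S r) u v k
      ... | no  _ = matrix k r c′

      doubled-at : ∀ r c′ → toℕ c′ ≡ suc k → doubled r c′ ≡ horner (S r) u v k
      doubled-at r c′ toℕc′≡k+1 with toℕ c′ ℕ.≟ suc k
      ... | yes _ = refl
      ... | no toℕc′≢k+1 = ⊥-elim (toℕc′≢k+1 toℕc′≡k+1)

      doubled-at₋ : ∀ r → doubled r c₋ ≡ horner (S r) u v k
      doubled-at₋ r with toℕ c₋ ℕ.≟ suc k
      ... | yes _ = refl
      ... | no  _ = trans (cong (entry k r) toℕc₋) (entry-≤ k r k ℕ.≤-refl)

      det-doubled : det (suc n) doubled ≡ 0ℤ
      det-doubled = det-adjacent-columns (suc n) doubled c₋ c (trans toℕc (cong suc (sym toℕc₋)))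
                      λ r → trans (doubled-at₋ r) (sym (doubled-at r c toℕc))

      toℕ≢ : ∀ {c′} → c′ ≢ c → toℕ c′ ≢ suc k
      toℕ≢ c′≢c toℕc′≡k+1 = c′≢c (toℕ-injective (trans toℕc′≡k+1 (sym toℕc)))

      off-c : ∀ r c′ → c′ ≢ c → matrix (suc k) r c′ ≡ matrix k r c′
      off-c r c′ c′≢c with toℕ c′ ℕ.≤? k
      ... | yes m≤k = entry-≤ (suc k) r (toℕ c′) (ℕ.m≤n⇒m≤1+n m≤k)
      ... | no  m≰k = entry-≰ (suc k) r (toℕ c′) λ m≤k+1 →
                        toℕ≢ c′≢c (ℕ.≤-antisym m≤k+1 (ℕ.≰⇒> m≰k))

      off-c-doubled : ∀ r c′ → c′ ≢ c → matrix (suc k) r c′ ≡ doubled r c′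
      off-c-doubled r c′ c′≢c with toℕ c′ ℕ.≟ suc k
      ... | yes toℕc′≡k+1 = ⊥-elim (toℕ≢ c′≢c toℕc′≡k+1)
      ... | no  _         = off-c r c′ c′≢c

      at-c : ∀ r → matrix (suc k) r c ≡ v ^ suc k * matrix k r c + u * doubled r c
      at-c r = begin
        entry (suc k) r (toℕ c)                           ≡⟨ cong (entry (suc k) r) toℕc ⟩
        entry (suc k) r (suc k)                           ≡⟨ entry-≤ (suc k) r (suc k) ℕ.≤-refl ⟩
        v ^ suc k * S r (suc k) + u * horner (S r) u v k  ≡⟨ cong₂ (λ x h → v ^ suc k * x + u * h)
             (sym (trans (cong (entry k r) toℕc) (entry-≰ k r (suc k) ℕ.1+n≰n))) (sym (doubled-at r c toℕc)) ⟩
        v ^ suc k * entry k r (toℕ c) + u * doubled r c   ∎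
        where open ≡-Reasoning

    det-matrix-suc : ∀ k → suc k ℕ.< suc n →
                     det (suc n) (matrix (suc k)) ≡ v ^ suc k * det (suc n) (matrix k)
    det-matrix-suc k k+1<N = begin
      det (suc n) (matrix (suc k))
        ≡⟨ det-linear (suc n) _ _ _ c (v ^ suc k) u off-c off-c-doubled at-c ⟩
      v ^ suc k * det (suc n) (matrix k) + u * det (suc n) doubled
        ≡⟨ cong (λ d → v ^ suc k * det (suc n) (matrix k) + u * d) det-doubled ⟩
      v ^ suc k * det (suc n) (matrix k) + u * 0ℤ
        ≡⟨ ring (v ^ suc k) (det (suc n) (matrix k)) u ⟩
      v ^ suc k * det (suc n) (matrix k) ∎
      where
      open ≡-Reasoning
      open Step k k+1<N
      ring : ∀ a b c → a * b + c * 0ℤ ≡ a * b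
      ring = solve-∀

    det-matrix : ∀ k → k ℕ.< suc n → ∃[ e ] det (suc n) (matrix k) ≡ v ^ e * det (suc n) rows
    det-matrix zero _ = 0 , trans det-matrix-0 (sym (ℤ.*-identityˡ _))
    det-matrix (suc k) k+1<N with det-matrix k (ℕ.<-trans (ℕ.n<1+n k) k+1<N)
    ... | e , det≡ = suc k ℕ.+ e , (begin
      det (suc n) (matrix (suc k))            ≡⟨ det-matrix-suc k k+1<N ⟩
      v ^ suc k * det (suc n) (matrix k)       ≡⟨ cong (v ^ suc k *_) det≡ ⟩
      v ^ suc k * (v ^ e * D)                  ≡⟨ sym (ℤ.*-assoc (v ^ suc k) (v ^ e) D) ⟩
      v ^ suc k * v ^ e * D                    ≡⟨ cong (_* D) (sym (ℤ.^-distribˡ-+-* v (suc k) e)) ⟩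
      v ^ (suc k ℕ.+ e) * D                    ∎)
      where open ≡-Reasoning
            D = det (suc n) rows

  det-∣-horner-rows : ∀ {d} → (∀ r → d ∣ horner (S r) u v n) →
                      ∃[ e ] d ∣ v ^ e * det (suc n) (λ r c → S r (toℕ c))
  det-∣-horner-rows {d} d∣rows with det-matrix n ℕ.≤-refl
  ... | e , det≡ = e , subst (d ∣_) det≡ (det-column-∣ (suc n) (matrix n) (fromℕ n) λ r →
                     subst (d ∣_) (sym (last-column r)) (d∣rows r))
    where last-column : ∀ r → matrix n r (fromℕ n) ≡ horner (S r) u v n
          last-column r = trans (cong (entry n r) (toℕ-fromℕ n)) (entry-≤ n r n ℕ.≤-refl)

-- sylvester F G r c reduces to sylvesterRow F G r (toℕ c).
sylvesterRow : (F G : Form) → Fin (deg F ℕ.+ deg G) → ℕ → ℤ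
sylvesterRow F G r k =
  if toℕ r ℕ.<ᵇ deg G then shifted (coefAt F) (toℕ r) k else shifted (coefAt G) (toℕ r ∸ deg G) k

sylvesterRow-∣ : ∀ {d} m cf G u v → d ∣ evalF (form (suc m) cf) u v → d ∣ evalF G u v →
                 ∀ r → d ∣ horner (sylvesterRow (form (suc m) cf) G r) u v (m ℕ.+ deg G)
sylvesterRow-∣ m cf G u v d∣F d∣G r with toℕ r ℕ.<ᵇ deg G in r<ᵇn
... | true  = shifted-row-∣ (form (suc m) cf) u v (toℕ r) (m ℕ.+ deg G)
                (subst (ℕ._≤ m ℕ.+ deg G) (ℕ.+-suc m (toℕ r)) (ℕ.+-monoʳ-≤ m r<n)) d∣F
  where r<n : toℕ r ℕ.< deg G
        r<n = ℕ.<ᵇ⇒< (toℕ r) (deg G) (subst T (sym r<ᵇn) _)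
... | false = shifted-row-∣ G u v (toℕ r ∸ deg G) (m ℕ.+ deg G)
                (subst (ℕ._≤ m ℕ.+ deg G) (sym (ℕ.m+[n∸m]≡n n≤r)) (ℕ.≤-pred (toℕ<n r))) d∣G
  where n≤r : deg G ℕ.≤ toℕ r
        n≤r = ℕ.≮⇒≥ λ r<n → subst T r<ᵇn (ℕ.<⇒<ᵇ r<n)

resultant-∣-v∤ : ∀ {p} m cf G u v → Prime p → ¬ (+ p ∣ v) →
                 + p ∣ evalF (form (suc m) cf) u v → + p ∣ evalF G u v → + p ∣ Res (form (suc m) cf) G
resultant-∣-v∤ m cf G u v p-prime p∤v p∣F p∣G
  with det-∣-horner-rows (sylvesterRow (form (suc m) cf) G) u v (sylvesterRow-∣ m cf G u v p∣F p∣G)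
... | e , p∣vᵉR = prime-∣-cancelˡ _ p-prime (prime∤-^ p-prime p∤v e) p∣vᵉR

leading-coefficient-∣ : ∀ {p} H u v → Prime p → ¬ (+ p ∣ u) → + p ∣ v → + p ∣ evalF H u v → + p ∣ coefAt H 0
leading-coefficient-∣ H u v p-prime p∤u p∣v p∣H with horner-mod-v (coefAt H) u v (deg H)
... | R , H≡ = prime-∣-cancelˡ (coefAt H 0) p-prime (prime∤-^ p-prime p∤u (deg H))
                 (∣m+n∣n⇒∣m (subst (_ ∣_) (trans (evalF-horner H u v) H≡) p∣H) (∣m⇒∣m*n R p∣v))

shifted-∣-at-0 : ∀ {d} a s → d ∣ a 0 → d ∣ shifted a s 0
shifted-∣-at-0 a zero    d∣a₀ = d∣a₀
shifted-∣-at-0 a (suc s) d∣a₀ = divides 0ℤ refl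

resultant-∣-v∣ : ∀ {p} m cf G u v → Prime p → ¬ (+ p ∣ u) → + p ∣ v →
                 + p ∣ evalF (form (suc m) cf) u v → + p ∣ evalF G u v → + p ∣ Res (form (suc m) cf) G
resultant-∣-v∣ m cf G u v p-prime p∤u p∣v p∣F p∣G = det-column-∣ _ (sylvester F G) zero column-0-∣
  where
  F = form (suc m) cf
  column-0-∣ : ∀ r → _ ∣ sylvester F G r zero
  column-0-∣ r with toℕ r ℕ.<ᵇ deg G
  ... | true  = shifted-∣-at-0 (coefAt F) (toℕ r) (leading-coefficient-∣ F u v p-prime p∤u p∣v p∣F)
  ... | false = shifted-∣-at-0 (coefAt G) (toℕ r ∸ deg G) (leading-coefficient-∣ G u v p-prime p∤u p∣v p∣G)

resultant-∣ : ∀ {p} F G u v → Prime p → 1 ℕ.≤ deg F → gcd u v ≡ 1ℤ →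
              + p ∣ evalF F u v → + p ∣ evalF G u v → + p ∣ Res F G
resultant-∣ {p} (form (suc m) cf) G u v p-prime _ gcd≡1 p∣F p∣G with + p ∣? v
... | no  p∤v = resultant-∣-v∤ m cf G u v p-prime p∤v p∣F p∣G
... | yes p∣v = resultant-∣-v∣ m cf G u v p-prime (λ p∣u → prime∤-coprime p-prime gcd≡1 p∣u p∣v) p∣v p∣F p∣G

lemma12p8 :
    (Δ : ℤ) → Squarefree Δ → ¬ (Σ ℚ (λ q → q *ℚ q ≡ (- Δ) /ℚ 1)) →
    (f : List ℤ) → (HasDegree f 3 ⊎ HasDegree f 4) → Separable f →
    (r : ℕ) (F : Fin r → Form) → (∀ i → IrreducibleForm (F i)) →
    prodForms r F ≈F homog4 f →
    (α : Fin r → ℤ) → (∀ i → Squarefree (α i)) →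
    (∀ i (p : ℕ) → Prime p → p ∣ℕ ∣ α i ∣ → χ≡-1 Δ p) →
    IsSquare (prodFin r α) →
    YStarNonempty Δ r F α →
    ∀ i → α i ∣ᵤ prodExcept r i (λ j → Res (F i) (F j))
lemma12p8 Δ _ _ _ _ _ r F F-irreducible _ α α-squarefree α-inert α-square (x , y , t , u , v , on-Y , u⊥v) i =
  squarefree-∣ _ (α-squarefree i) primes-∣
  where
  value-∣ : ∀ {p} → Prime p → ∀ j → + p ∣ α j → + p ∣ evalF (F j) u v
  value-∣ p-prime j p∣αⱼ =
    inert-∣-value Δ (x j) (y j) (t j) (evalF (F j) u v) p-prime
      (χ≡-1⇒Inert Δ p-prime (α-inert j _ p-prime (∣⇒∣ᵤ p∣αⱼ))) (α-squarefree j) p∣αⱼ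
      (proj₁ (on-Y j)) (proj₂ (proj₂ (on-Y j)))
  primes-∣ : ∀ p → Prime p → p ∣ℕ ∣ α i ∣ → p ∣ℕ ∣ prodExcept r i (λ j → Res (F i) (F j)) ∣
  primes-∣ p p-prime p∣αᵢ with square-product⇒∣-another p-prime r α α-squarefree α-square i (∣ᵤ⇒∣ p∣αᵢ)
  ... | j , j≢i , p∣αⱼ = ∣⇒∣ᵤ (prodExcept-∣ r i _ j (j≢i ∘ sym)
          (resultant-∣ (F i) (F j) u v p-prime (proj₁ (F-irreducible i)) u⊥v
                       (value-∣ p-prime i (∣ᵤ⇒∣ p∣αᵢ)) (value-∣ p-prime j p∣αⱼ)))
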